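{- Let $n\in\mathbb{Z}^+$ and consider, in the ring $\mathbb{Z}$, the Frobenius template $(\mathbb{N},(n+\mathbb{N})\cup\{0\},\mathbb{N})$, so that for $a_1,\dots,a_k\in\mathbb{N}$, $MN(a_1,\dots,a_k)=\{\sum_{i=1}^k\lambda_ia_i:\lambda_1,\dots,\lambda_k\in(n+\mathbb{N})\cup\{0\}\}$ and $\mathrm{Frob}(a_1,\dots,a_k)=\{w\in\mathbb{Z}: w+\mathbb{N}\subseteq MN(a_1,\dots,a_k)\}$. If $a_1,\dots,a_k\in\mathbb{N}$ are coprime, then \[(a_1+\dots+a_k)n+\chi(a_1,\dots,a_k)+\mathbb{N}\subseteq\mathrm{Frob}(a_1,\dots,a_k).\]
   Context: $\mathbb{N}$ denotes the nonnegative integers, $\mathbb{Z}^+=\mathbb{N}\setminus\{0\}$, and $n+\mathbb{N}=\{n+m:m\in\mathbb{N}\}$. Nonnegative integers $a_1,\dots,a_k$ are coprime if $\gcd(a_1,\dots,a_k)=1$. For coprime $a_1,\dots,a_k\in\mathbb{N}$, $\chi(a_1,\dots,a_k)$ denotes the classical Frobenius quantity: the least $w\in\mathbb{N}$ such that $w+\mathbb{N}\subseteq\{\sum_{i=1}^k\lambda_ia_i:\lambda_1,\dots,\lambda_k\in\mathbb{N}\}$. -}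

module Defs where

open import Data.Nat using (ℕ; zero; suc; _+_; _*_; _≤_)
open import Data.Nat.GCD using (gcd)
open import Data.Fin using (Fin; zero; suc)
open import Data.Integer using (ℤ; +_)
import Data.Integer as ℤ
open import Data.Product using (Σ; _×_)
open import Data.Sum using (_⊎_)
open import Relation.Binary.PropositionalEquality using (_≡_)

sumF : {k : ℕ} → (Fin k → ℕ) → ℕ
sumF {zero}  f = 0
sumF {suc k} f = f zero + sumF (λ i → f (suc i))

gcdF : {k : ℕ} → (Fin k → ℕ) → ℕ
gcdF {zero}  f = 0
gcdF {suc k} f = gcd (f zero) (gcdF (λ i → f (suc i)))

Coprime : {k : ℕ} → (Fin k → ℕ) → Set
Coprime a = gcdF a ≡ 1

InSpan : {k : ℕ} → (Fin k → ℕ) → ℕ → Set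
InSpan {k} a x = Σ (Fin k → ℕ) λ l → x ≡ sumF (λ i → l i * a i)

TailInSpan : {k : ℕ} → (Fin k → ℕ) → ℕ → Set
TailInSpan a w = ∀ (m : ℕ) → InSpan a (w + m)

IsChi : {k : ℕ} → (Fin k → ℕ) → ℕ → Set
IsChi a w = TailInSpan a w × (∀ (v : ℕ) → TailInSpan a v → w ≤ v)

MN : (n : ℕ) {k : ℕ} → (Fin k → ℕ) → ℤ → Set
MN n {k} a z = Σ (Fin k → ℕ) λ l →
  (∀ i → l i ≡ 0 ⊎ n ≤ l i) × (z ≡ + sumF (λ i → l i * a i))

Frob : (n : ℕ) {k : ℕ} → (Fin k → ℕ) → ℤ → Set
Frob n a w = ∀ (m : ℕ) → MN n a (w ℤ.+ + m)

{-# OPTIONS --safe #-}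
module Submission where

-- Shifting every coefficient λᵢ of a representation by n lands in the
-- admissible set n + ℕ and adds exactly (a₁ + ⋯ + aₖ)·n to the value, so
-- (Σ aᵢ)·n + (χ + ℕ) ⊆ MN.

open import Defs
open import Data.Nat using (ℕ; zero; suc; _+_; _*_; _≤_)
open import Data.Nat.Properties using (m≤m+n)
open import Data.Nat.Tactic.RingSolver using (solve-∀)
open import Data.Fin using (Fin)
import Data.Fin as Fin
open import Data.Integer using (+_)
open import Data.Product using (_,_; proj₁)
open import Data.Sum using (inj₂)
open import Relation.Binary.PropositionalEquality using (_≡_; refl; cong; sym; subst)
open Relation.Binary.PropositionalEquality.≡-Reasoning

sumF-shift : (n : ℕ) {k : ℕ} (a l : Fin k → ℕ) →
  sumF (λ i → (n + l i) * a i) ≡ sumF a * n + sumF (λ i → l i * a i)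
sumF-shift n {zero}  a l = refl
sumF-shift n {suc k} a l = begin
  (n + l₀) * a₀ + sumF (λ i → (n + l (Fin.suc i)) * a (Fin.suc i))
    ≡⟨ cong (_+_ ((n + l₀) * a₀)) (sumF-shift n (λ i → a (Fin.suc i)) (λ i → l (Fin.suc i))) ⟩
  (n + l₀) * a₀ + (sumF (λ i → a (Fin.suc i)) * n + sumF (λ i → l (Fin.suc i) * a (Fin.suc i)))
    ≡⟨ regroup n l₀ a₀ _ _ ⟩
  (a₀ + sumF (λ i → a (Fin.suc i))) * n + (l₀ * a₀ + sumF (λ i → l (Fin.suc i) * a (Fin.suc i))) ∎
  where
  a₀ = a Fin.zero
  l₀ = l Fin.zero
  regroup : ∀ n l₀ a₀ s t → (n + l₀) * a₀ + (s * n + t) ≡ (a₀ + s) * n + (l₀ * a₀ + t)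
  regroup = solve-∀

span⇒shifted-MN : (n : ℕ) {k : ℕ} (a : Fin k → ℕ) {x : ℕ} →
  InSpan a x → MN n a (+ (sumF a * n + x))
span⇒shifted-MN n a {x} (l , x≡) =
  (λ i → n + l i) , (λ i → inj₂ (m≤m+n n (l i))) , cong +_ sum≡
  where
  sum≡ : sumF a * n + x ≡ sumF (λ i → (n + l i) * a i)
  sum≡ = begin
    sumF a * n + x                        ≡⟨ cong (_+_ (sumF a * n)) x≡ ⟩
    sumF a * n + sumF (λ i → l i * a i)   ≡⟨ sym (sumF-shift n a l) ⟩
    sumF (λ i → (n + l i) * a i)          ∎

proposition3p1 : (n : ℕ) → 1 ≤ n → (k : ℕ) → (a : Fin k → ℕ) → Coprime a →
    (χ : ℕ) → IsChi a χ →
    ∀ (m : ℕ) → Frob n a (+ (sumF a * n + χ + m))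
proposition3p1 n _ k a _ χ isChi m m′ =
  subst (λ x → MN n a (+ x)) (reassoc (sumF a * n) χ m m′)
    (span⇒shifted-MN n a (proj₁ isChi (m + m′)))
  where
  reassoc : ∀ s c x y → s + (c + (x + y)) ≡ s + c + x + y
  reassoc = solve-∀
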